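{- Let $p>5$ be prime, $k\in\mathbb Z_{\ge0}$, $a=[k]_0$ and $b=(k-a)/p$ (so $k=a+bp$). Then for every $r\in\mathbb Z_p^\times$, $$\frac{(r)_k}{(1)_k}=\frac{ -\Gamma_p(r+k)}{\Gamma_p(1+k)\,\Gamma_p(r)}\cdot\frac{(r')_b}{(1)_b}\cdot\bigl((r'+b)p\bigr)^{\nu(a,[-r]_0)}.$$
   Context: $\Gamma_p$ is Morita's $p$-adic Gamma function. For $x\in\mathbb Z_p$, $[x]_0\in\{0,\dots,p-1\}$ is its first $p$-adic digit. For $r\in\mathbb Z_p$, $r'=(r+[-r]_0)/p$ (Dwork's dash operation). $(x)_k=x(x+1)\cdots(x+k-1)$, $(x)_0=1$. For an integer $a$ and real $x$, $\nu(a,x)=-\lfloor (x-a)/(p-1)\rfloor$; for $x\in\{0,\dots,p-1\}$ and $0\le a<p$ this equals $0$ if $a\le x$ and $1$ if $x<a<p$. -}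

module Defs where

-- p-adic integers Z_p modelled as their sequences of residues mod p^n
-- (the inverse limit lim Z/p^n), with all operations computed levelwise.

open import Data.Nat using (ℕ; zero; suc; _+_; _*_; _∸_; _^_; _≤_; _<_; _≡ᵇ_; NonZero)
open import Data.Nat.Properties using (m^n≢0)
open import Data.Nat.DivMod using (_%_; _/_)
open import Data.Nat.Divisibility using (_∣?_)
open import Data.Bool using (Bool; true; false; if_then_else_)
open import Data.Product using (_×_)
open import Relation.Nullary.Decidable using (does)
open import Relation.Binary.PropositionalEquality using (_≡_)

module Padic (p : ℕ) .{{p≢0 : NonZero p}} where

  -- raw sequence of residues: x n is meant to be x mod p^n
  Seq : Set
  Seq = ℕ → ℕ

  md : ℕ → ℕ → ℕ
  md n x = _%_ x (p ^ n) {{m^n≢0 p n}}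

  IsZp : Seq → Set
  IsZp x = ∀ n → (x n < p ^ n) × (md n (x (suc n)) ≡ x n)

  _≈_ : Seq → Seq → Set
  x ≈ y = ∀ n → md n (x n) ≡ md n (y n)

  ι : ℕ → Seq
  ι m n = md n m

  _⊕_ : Seq → Seq → Seq
  (x ⊕ y) n = md n (x n + y n)

  _⊗_ : Seq → Seq → Seq
  (x ⊗ y) n = md n (x n * y n)

  ⊖_ : Seq → Seq
  (⊖ x) n = md n (p ^ n ∸ md n (x n))

  pow : Seq → ℕ → Seq
  pow x zero = ι 1
  pow x (suc e) = x ⊗ pow x e

  poch : Seq → ℕ → Seq
  poch x zero = ι 1
  poch x (suc k) = poch x k ⊗ (x ⊕ ι k)

  digit0 : Seq → ℕ
  digit0 x = md 1 (x 1)

  -- Dwork's dash operation r' = (r + [-r]_0)/p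
  dash : Seq → Seq
  dash r n = md (suc n) (r (suc n) + digit0 (⊖ r)) / p

  prodUnits : ℕ → ℕ → ℕ
  prodUnits n zero = md n 1
  prodUnits n (suc j) with j ≡ᵇ 0 | does (p ∣? j)
  ... | true  | _     = prodUnits n j
  ... | false | true  = prodUnits n j
  ... | false | false = md n (prodUnits n j * j)

  isEven : ℕ → Bool
  isEven zero = true
  isEven (suc zero) = false
  isEven (suc (suc m)) = isEven m

  -- Morita's p-adic Gamma function: on positive integers
  -- Γ_p(m) = (-1)^m ∏_{0<j<m, p∤j} j, Γ_p(0) = 1, extended to Z_p by
  -- continuity; since |Γ_p(x) - Γ_p(y)|_p ≤ |x - y|_p (p odd), the value of
  -- Γ_p(x) mod p^n is Γ_p(m) mod p^n for any m ≡ x mod p^n.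
  Γp : Seq → Seq
  Γp x n = if isEven (md n (x n))
             then prodUnits n (md n (x n))
             else md n (p ^ n ∸ prodUnits n (md n (x n)))

  ν : ℕ → ℕ → ℕ
  ν a x = if does (Data.Nat._≤?_ a x) then 0 else 1

module Submission where

-- Elements of ℤ_p are compatible residue sequences and every operation is
-- computed levelwise, so the identity is a congruence modulo M = p^n for each
-- level n (level 0 is trivial).  Fix a level, let R ∈ ℕ represent r and put
-- t = ⌊R/p⌋ + 1, which represents r'.
--
-- On ℕ, Morita's function is
--   Γ(m) = (-1)^m U(m) with U(m) = ∏ {j < m | 0 < j, p ∤ j}.  Pairing every
--   unit below M - 1 with its inverse (module Pairing) gives Wilson's theorem
--   U(M) ≡ -1 (mod M), hence Γ(m + M) ≡ Γ(m): the level-n value of Γ_p is Γ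
--   applied to any representative.
-- * An exact identity in ℕ (module ExactIdentity).  Splitting off the
--   multiples of p, (R)_k U(R) = U(R+k) P(R,k) where P(R,k) is the product of
--   the multiples of p in [R, R+k).  These are p t, p (t+1), …; there are b of
--   them when a ≤ d = [-r]_0 and b+1 otherwise, so
--   P(R,k) = p^b (t)_b ((t+b)p)^ν(a,d); likewise P(1,k) = p^b b!.
-- * Evaluation (modules Evaluation, LevelIdentity).  Every operation of Defs at
--   level n reduces modulo M to the corresponding integer operation on
--   representatives (congruences in ℤ are handled by module IntMod), so both
--   sides of the lemma are congruent to the two sides of the exact identity,
--   multiplied by the signs of the Γ values.

open import Defs
open import Data.Bool using (true; false; not; if_then_else_)
open import Data.Empty using (⊥-elim)
open import Data.Integer as ℤ using (ℤ; +_; -[1+_])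
import Data.Integer.DivMod as ℤ
import Data.Integer.Properties as ℤP
open import Data.Integer.Tactic.RingSolver renaming (solve-∀ to ℤ-solve-∀)
open import Data.List using (List; []; _∷_; length; filter; downFrom)
open import Data.List.Membership.Propositional using (_∈_)
open import Data.List.Membership.Propositional.Properties
  using (∈-filter⁺; ∈-filter⁻; ∈-downFrom⁺; ∈-downFrom⁻)
open import Data.List.Properties using (filter-accept; filter-reject; filter-all; length-filter)
import Data.List.Relation.Unary.All as All
open import Data.List.Relation.Unary.Any using (here; there)
open import Data.List.Relation.Unary.Unique.Propositional using (Unique; []; _∷_)
open import Data.List.Relation.Unary.Unique.Propositional.Properties using (filter⁺; downFrom⁺)
open import Data.Nat
open import Data.Nat.Coprimality using (Coprime; coprime-divisor; coprime-Bézout) renaming (sym to coprime-sym)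
open import Data.Nat.DivMod
open import Data.Nat.Divisibility
open import Data.Nat.GCD using (module Bézout)
open import Data.Nat.ListAction using (product)
open import Data.Nat.Primality using (Prime; prime⇒irreducible)
open import Data.Nat.Properties
open import Data.Nat.Tactic.RingSolver using (solve-∀)
open import Data.Product using (Σ; _,_; proj₁; proj₂; _×_)
open import Data.Sum using (_⊎_; inj₁; inj₂)
open import Function using (_∘_)
open import Relation.Nullary using (¬_; Dec; yes; no; ¬?; _×-dec_)
open import Relation.Nullary.Decidable using (dec-true; dec-false)
open import Relation.Binary.Bundles using (Setoid)
import Relation.Binary.Reasoning.Setoid as SetoidReasoning
open import Relation.Binary.PropositionalEquality

module NatMod (M : ℕ) .{{_ : NonZero M}} where

  *-cong-% : ∀ {a b c d} → a % M ≡ b % M → c % M ≡ d % M → (a * c) % M ≡ (b * d) % M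
  *-cong-% {a} {b} {c} {d} a≡b c≡d = begin
    (a * c) % M             ≡⟨ %-distribˡ-* a c M ⟩
    ((a % M) * (c % M)) % M ≡⟨ cong₂ (λ u v → (u * v) % M) a≡b c≡d ⟩
    ((b % M) * (d % M)) % M ≡⟨ %-distribˡ-* b d M ⟨
    (b * d) % M             ∎
    where open ≡-Reasoning

  +-cong-% : ∀ {a b c d} → a % M ≡ b % M → c % M ≡ d % M → (a + c) % M ≡ (b + d) % M
  +-cong-% {a} {b} {c} {d} a≡b c≡d = begin
    (a + c) % M             ≡⟨ %-distribˡ-+ a c M ⟩
    ((a % M) + (c % M)) % M ≡⟨ cong₂ (λ u v → (u + v) % M) a≡b c≡d ⟩
    ((b % M) + (d % M)) % M ≡⟨ %-distribˡ-+ b d M ⟨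
    (b + d) % M             ∎
    where open ≡-Reasoning

module Pairing (M : ℕ) .{{_ : NonZero M}} (σ : ℕ → ℕ) where
  open NatMod M

  record PairedIn (xs : List ℕ) (x : ℕ) : Set where
    field
      partner∈   : σ x ∈ xs
      involutive : σ (σ x) ≡ x
      inverse    : (x * σ x) % M ≡ 1 % M
      fixed⇒1    : σ x ≡ x → x ≡ 1

  moveTo : ∀ {xs ys x} → PairedIn xs x → σ x ∈ ys → PairedIn ys x
  moveTo q σx∈ys = record { PairedIn q ; partner∈ = σx∈ys }

  ∈-tail : ∀ {x y : ℕ} {xs} → y ∈ x ∷ xs → y ≢ x → y ∈ xs
  ∈-tail (here y≡x) y≢x = ⊥-elim (y≢x y≡x)
  ∈-tail (there y∈xs) _ = y∈xs

  ≢? : ∀ z y → Dec (y ≢ z)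
  ≢? z y = ¬? (y ≟ z)

  _without_ : List ℕ → ℕ → List ℕ
  xs without z = filter (≢? z) xs

  product-without : ∀ {z xs} → Unique xs → z ∈ xs → product xs ≡ z * product (xs without z)
  product-without {z} {x ∷ xs} (x∉xs ∷ _) (here refl) = cong (λ l → x * product l) (sym (begin
    (x ∷ xs) without x ≡⟨ filter-reject (≢? x) (λ x≢x → x≢x refl) ⟩
    xs without x       ≡⟨ filter-all (≢? x) (All.map (_∘ sym) x∉xs) ⟩
    xs                 ∎))
    where open ≡-Reasoning
  product-without {z} {x ∷ xs} (x∉xs ∷ uniq) (there z∈xs) = begin
    x * product xs                   ≡⟨ cong (x *_) (product-without uniq z∈xs) ⟩
    x * (z * product (xs without z)) ≡⟨ x*[z*w]≡z*[x*w] x z _ ⟩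
    z * (x * product (xs without z)) ≡⟨ cong (z *_) (cong product (filter-accept (≢? z) (All.lookup x∉xs z∈xs))) ⟨
    z * product ((x ∷ xs) without z) ∎
    where
      open ≡-Reasoning
      x*[z*w]≡z*[x*w] : ∀ x z w → x * (z * w) ≡ z * (x * w)
      x*[z*w]≡z*[x*w] = solve-∀

  -- induction on the length (bounded by the fuel n): a fixed point is 1 and
  -- is dropped, any other element is removed together with its partner
  pairing : ∀ n xs → length xs ≤ n → Unique xs → (∀ {x} → x ∈ xs → PairedIn xs x) →
            product xs % M ≡ 1 % M
  pairing n [] _ _ _ = refl
  pairing (suc n) (x ∷ xs) (s≤s len) (x∉xs ∷ uniq) paired with σ x ≟ x
  ... | yes σx≡x = begin
      (x * product xs) % M ≡⟨ cong (λ u → (u * product xs) % M) (PairedIn.fixed⇒1 px σx≡x) ⟩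
      (1 * product xs) % M ≡⟨ cong (_% M) (*-identityˡ (product xs)) ⟩
      product xs % M       ≡⟨ pairing n xs len uniq pairedTail ⟩
      1 % M                ∎
    where
      open ≡-Reasoning
      px = paired (here refl)
      pairedTail : ∀ {y} → y ∈ xs → PairedIn xs y
      pairedTail {y} y∈xs = moveTo py (∈-tail (PairedIn.partner∈ py) σy≢x)
        where
          py = paired (there y∈xs)
          σy≢x : σ y ≢ x
          σy≢x σy≡x = All.lookup x∉xs y∈xs (begin
            x         ≡⟨ σx≡x ⟨
            σ x       ≡⟨ cong σ σy≡x ⟨
            σ (σ y)   ≡⟨ PairedIn.involutive py ⟩
            y         ∎)
  ... | no σx≢x = begin
      (x * product xs) % M           ≡⟨ cong (λ u → (x * u) % M) (product-without uniq σx∈xs) ⟩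
      (x * (σ x * product rest)) % M ≡⟨ cong (_% M) (*-assoc x (σ x) _) ⟨
      (x * σ x * product rest) % M   ≡⟨ *-cong-% (PairedIn.inverse px) restProduct ⟩
      (1 * 1) % M                    ∎
    where
      open ≡-Reasoning
      px = paired (here refl)
      σx∈xs = ∈-tail (PairedIn.partner∈ px) σx≢x
      rest = xs without σ x
      pairedRest : ∀ {y} → y ∈ rest → PairedIn rest y
      pairedRest {y} y∈rest = moveTo py (∈-filter⁺ (≢? (σ x)) σy∈xs σy≢σx)
        where
          y∈xs,y≢σx = ∈-filter⁻ (≢? (σ x)) y∈rest
          y∈xs = proj₁ y∈xs,y≢σx
          py = paired (there y∈xs)
          σσy≡y = PairedIn.involutive py
          σy∈xs : σ y ∈ xs
          σy∈xs = ∈-tail (PairedIn.partner∈ py)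
            (λ σy≡x → proj₂ y∈xs,y≢σx (trans (sym σσy≡y) (cong σ σy≡x)))
          σy≢σx : σ y ≢ σ x
          σy≢σx σy≡σx = All.lookup x∉xs y∈xs
            (trans (sym (PairedIn.involutive px)) (trans (cong σ (sym σy≡σx)) σσy≡y))
      restProduct : product rest % M ≡ 1 % M
      restProduct = pairing n rest (≤-trans (length-filter _ xs) len) (filter⁺ _ uniq) pairedRest

-- reduction modulo equal moduli (the NonZero proofs may differ)
%-cong-modulus : ∀ x {a b} .{{_ : NonZero a}} .{{_ : NonZero b}} → a ≡ b → x % a ≡ x % b
%-cong-modulus x refl = refl

pos-+* : ∀ a b c → + (a + b * c) ≡ + a ℤ.+ + b ℤ.* + c
pos-+* a b c = trans (ℤP.pos-+ a (b * c)) (cong (λ u → + a ℤ.+ u) (ℤP.pos-* b c))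

module IntMod (M : ℕ) .{{_ : NonZero M}} where

  infix 4 _≋_
  record _≋_ (a b : ℤ) : Set where
    constructor _,_
    field
      quotient : ℤ
      a≡b+qM   : a ≡ b ℤ.+ quotient ℤ.* + M

  ≋-refl : ∀ {a} → a ≋ a
  ≋-refl {a} = ℤ.0ℤ , a≡a+0m a (+ M)
    where
      a≡a+0m : ∀ a m → a ≡ a ℤ.+ ℤ.0ℤ ℤ.* m
      a≡a+0m = ℤ-solve-∀

  ≋-reflexive : ∀ {a b} → a ≡ b → a ≋ b
  ≋-reflexive refl = ≋-refl

  -- (no matching on the equation, so that the quotient -q computes)
  ≋-sym : ∀ {a b} → a ≋ b → b ≋ a
  ≋-sym {a} {b} (q , a≡b+qM) = ℤ.- q , trans (b≡[b+qm]-qm b q (+ M)) (cong (λ u → u ℤ.+ (ℤ.- q) ℤ.* + M) (sym a≡b+qM))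
    where
      b≡[b+qm]-qm : ∀ b q m → b ≡ (b ℤ.+ q ℤ.* m) ℤ.+ (ℤ.- q) ℤ.* m
      b≡[b+qm]-qm = ℤ-solve-∀

  ≋-trans : ∀ {a b c} → a ≋ b → b ≋ c → a ≋ c
  ≋-trans {c = c} (q , refl) (q' , refl) = q' ℤ.+ q , regroup c q' q (+ M)
    where
      regroup : ∀ c q' q m → c ℤ.+ q' ℤ.* m ℤ.+ q ℤ.* m ≡ c ℤ.+ (q' ℤ.+ q) ℤ.* m
      regroup = ℤ-solve-∀

  ≋-+ : ∀ {a b c d} → a ≋ b → c ≋ d → a ℤ.+ c ≋ b ℤ.+ d
  ≋-+ {b = b} {d = d} (q , refl) (q' , refl) = q ℤ.+ q' , regroup b d q q' (+ M)
    where
      regroup : ∀ b d q q' m → (b ℤ.+ q ℤ.* m) ℤ.+ (d ℤ.+ q' ℤ.* m) ≡ (b ℤ.+ d) ℤ.+ (q ℤ.+ q') ℤ.* m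
      regroup = ℤ-solve-∀

  ≋-* : ∀ {a b c d} → a ≋ b → c ≋ d → a ℤ.* c ≋ b ℤ.* d
  ≋-* {b = b} {d = d} (q , refl) (q' , refl) =
    q ℤ.* d ℤ.+ b ℤ.* q' ℤ.+ q ℤ.* q' ℤ.* + M , expand b d q q' (+ M)
    where
      expand : ∀ b d q q' m → (b ℤ.+ q ℤ.* m) ℤ.* (d ℤ.+ q' ℤ.* m) ≡
                              b ℤ.* d ℤ.+ (q ℤ.* d ℤ.+ b ℤ.* q' ℤ.+ q ℤ.* q' ℤ.* m) ℤ.* m
      expand = ℤ-solve-∀

  ≋-neg : ∀ {a b} → a ≋ b → ℤ.- a ≋ ℤ.- b
  ≋-neg {b = b} (q , refl) = ℤ.- q , negate b q (+ M)
    where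
      negate : ∀ b q m → ℤ.- (b ℤ.+ q ℤ.* m) ≡ ℤ.- b ℤ.+ (ℤ.- q) ℤ.* m
      negate = ℤ-solve-∀

  M≋0 : + M ≋ ℤ.0ℤ
  M≋0 = ℤ.1ℤ , m≡0+1m (+ M)
    where
      m≡0+1m : ∀ m → m ≡ ℤ.0ℤ ℤ.+ ℤ.1ℤ ℤ.* m
      m≡0+1m = ℤ-solve-∀

  M-e≋-e : ∀ {e} → e ≤ M → + (M ∸ e) ≋ ℤ.- + e
  M-e≋-e {e} e≤M = ℤ.1ℤ , (begin
    + (M ∸ e)                 ≡⟨ ℤP.⊖-≥ e≤M ⟨
    M ℤ.⊖ e                   ≡⟨ ℤP.m-n≡m⊖n M e ⟨
    + M ℤ.- + e               ≡⟨ m-e≡-e+1m (+ M) (+ e) ⟩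
    ℤ.- + e ℤ.+ ℤ.1ℤ ℤ.* + M  ∎)
    where
      open ≡-Reasoning
      m-e≡-e+1m : ∀ m e → m ℤ.- e ≡ ℤ.- e ℤ.+ ℤ.1ℤ ℤ.* m
      m-e≡-e+1m = ℤ-solve-∀

  ≋-setoid : Setoid _ _
  ≋-setoid = record
    { Carrier = ℤ ; _≈_ = _≋_
    ; isEquivalence = record { refl = ≋-refl ; sym = ≋-sym ; trans = ≋-trans } }

  ≋-%ℕ : ∀ c → c ≋ + (c ℤ.%ℕ M)
  ≋-%ℕ c = c ℤ./ℕ M , ℤ.a≡a%ℕn+[a/ℕn]*n c M

  ≋-% : ∀ x → + (x % M) ≋ + x
  ≋-% x = ≋-sym (≋-%ℕ (+ x))

  %⇒≋ : ∀ {x y} → x % M ≡ y % M → + x ≋ + y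
  %⇒≋ {x} {y} x≡y = ≋-trans (≋-sym (≋-% x)) (subst (λ z → + z ≋ + y) (sym x≡y) (≋-% y))

  ≋⁺⇒% : ∀ {x y} q → + x ≡ + y ℤ.+ + q ℤ.* + M → x % M ≡ y % M
  ≋⁺⇒% {x} {y} q eq = begin
    x % M           ≡⟨ cong (_% M) (ℤP.+-injective (trans eq (sym (pos-+* y q M)))) ⟩
    (y + q * M) % M ≡⟨ [m+kn]%n≡m%n y q M ⟩
    y % M           ∎
    where open ≡-Reasoning

  ≋⇒% : ∀ {x y} → + x ≋ + y → x % M ≡ y % M
  ≋⇒% (+ q , eq) = ≋⁺⇒% q eq
  ≋⇒% (-[1+ q ] , eq) = sym (≋⁺⇒% (suc q) (_≋_.a≡b+qM (≋-sym (-[1+ q ] , eq))))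

module OddPrime (p : ℕ) .{{_ : NonZero p}} (p-prime : Prime p) (2<p : 2 < p) where
  open Padic p

  p∤1 : ¬ p ∣ 1
  p∤1 p∣1 = <⇒≢ (<⇒≤ 2<p) (sym (∣1⇒≡1 p∣1))

  p∤2 : ¬ p ∣ 2
  p∤2 p∣2 = <⇒≱ 2<p (∣⇒≤ p∣2)

  coprime-p : ∀ {x} → ¬ p ∣ x → Coprime x p
  coprime-p p∤x (i∣x , i∣p) with prime⇒irreducible p-prime i∣p
  ... | inj₁ i≡1 = i≡1
  ... | inj₂ refl = ⊥-elim (p∤x i∣x)

  coprime-p^ : ∀ {x} e → ¬ p ∣ x → Coprime x (p ^ e)
  coprime-p^ zero _ (_ , i∣1) = ∣1⇒≡1 i∣1
  coprime-p^ (suc e) p∤x (i∣x , i∣p*p^e) =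
    coprime-p^ e p∤x (i∣x , coprime-divisor (λ (j∣i , j∣p) → coprime-p p∤x (∣-trans j∣i i∣x , j∣p)) i∣p*p^e)

  p^∣-cancel : ∀ {e a b} → p ^ e ∣ a * b → ¬ p ∣ b → p ^ e ∣ a
  p^∣-cancel {e} {a} {b} p^e∣ab p∤b =
    coprime-divisor (coprime-sym (coprime-p^ e p∤b)) (subst (p ^ e ∣_) (*-comm a b) p^e∣ab)

  isEven-suc : ∀ m → isEven (suc m) ≡ not (isEven m)
  isEven-suc zero = refl
  isEven-suc (suc zero) = refl
  isEven-suc (suc (suc m)) = isEven-suc m

  isEven-+2* : ∀ m k → isEven (m + 2 * k) ≡ isEven m
  isEven-+2* m zero = cong isEven (+-identityʳ m)
  isEven-+2* m (suc k) = trans (cong isEven (m+2[1+k]≡2+[m+2k] m k)) (isEven-+2* m k)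
    where
      m+2[1+k]≡2+[m+2k] : ∀ m k → m + 2 * suc k ≡ suc (suc (m + 2 * k))
      m+2[1+k]≡2+[m+2k] = solve-∀

  even⇒2∣ : ∀ m → isEven m ≡ true → 2 ∣ m
  even⇒2∣ zero _ = 2 ∣0
  even⇒2∣ (suc (suc m)) even = subst (2 ∣_) (+-comm m 2) (∣m∣n⇒∣m+n (even⇒2∣ m even) ∣-refl)

  odd⇒1+2k : ∀ m → isEven m ≡ false → Σ ℕ λ k → m ≡ 1 + 2 * k
  odd⇒1+2k (suc zero) _ = 0 , refl
  odd⇒1+2k (suc (suc m)) odd with odd⇒1+2k m odd
  ... | k , refl = suc k , 3+2k≡1+2[1+k] k
    where
      3+2k≡1+2[1+k] : ∀ k → 3 + 2 * k ≡ 1 + 2 * suc k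
      3+2k≡1+2[1+k] = solve-∀

  odd-* : ∀ {a b} → isEven a ≡ false → isEven b ≡ false → isEven (a * b) ≡ false
  odd-* {a} {b} odd-a odd-b with odd⇒1+2k a odd-a | odd⇒1+2k b odd-b
  ... | k , refl | j , refl = trans (cong isEven (expand k j)) (isEven-+2* 1 (k + j + 2 * k * j))
    where
      expand : ∀ k j → (1 + 2 * k) * (1 + 2 * j) ≡ 1 + 2 * (k + j + 2 * k * j)
      expand = solve-∀

  p-odd : isEven p ≡ false
  p-odd with isEven p in even
  ... | false = refl
  ... | true with prime⇒irreducible p-prime (even⇒2∣ p even)
  ...   | inj₂ refl = ⊥-elim (<-irrefl refl 2<p)

  p^-odd : ∀ e → isEven (p ^ e) ≡ false
  p^-odd zero = refl
  p^-odd (suc e) = odd-* {p} {p ^ e} p-odd (p^-odd e)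

  sign : ℕ → ℤ
  sign m = if isEven m then ℤ.1ℤ else ℤ.-1ℤ

  sign-suc : ∀ m → sign (suc m) ≡ ℤ.- sign m
  sign-suc m rewrite isEven-suc m with isEven m
  ... | true = refl
  ... | false = refl

  sign-+ : ∀ m n → sign (m + n) ≡ sign m ℤ.* sign n
  sign-+ zero n = sym (ℤP.*-identityˡ (sign n))
  sign-+ (suc m) n = begin
    sign (suc (m + n))           ≡⟨ sign-suc (m + n) ⟩
    ℤ.- sign (m + n)             ≡⟨ cong ℤ.-_ (sign-+ m n) ⟩
    ℤ.- (sign m ℤ.* sign n)      ≡⟨ ℤP.neg-distribˡ-* (sign m) (sign n) ⟩
    ℤ.- sign m ℤ.* sign n        ≡⟨ cong (ℤ._* sign n) (sign-suc m) ⟨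
    sign (suc m) ℤ.* sign n      ∎
    where open ≡-Reasoning

  IsUnit : ℕ → Set
  IsUnit j = j ≢ 0 × ¬ p ∣ j

  isUnit? : ∀ j → Dec (IsUnit j)
  isUnit? j = ¬? (j ≟ 0) ×-dec ¬? (p ∣? j)

  units : ℕ → List ℕ
  units m = filter isUnit? (downFrom m)

  U : ℕ → ℕ
  U m = product (units m)

  U-unit : ∀ {j} → IsUnit j → U (suc j) ≡ j * U j
  U-unit unit = cong product (filter-accept isUnit? unit)

  U-nonunit : ∀ {j} → ¬ IsUnit j → U (suc j) ≡ U j
  U-nonunit nonunit = cong product (filter-reject isUnit? nonunit)

  ∈-units⁻ : ∀ {x m} → x ∈ units m → IsUnit x × x < m
  ∈-units⁻ x∈units with ∈-filter⁻ isUnit? x∈units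
  ... | x∈downFrom , unit = unit , ∈-downFrom⁻ x∈downFrom

  ∈-units⁺ : ∀ {x m} → IsUnit x → x < m → x ∈ units m
  ∈-units⁺ unit x<m = ∈-filter⁺ isUnit? (∈-downFrom⁺ x<m) unit

  units-unique : ∀ m → Unique (units m)
  units-unique m = filter⁺ isUnit? (downFrom⁺ m)

  Γℕ : ℕ → ℤ
  Γℕ m = sign m ℤ.* + U m

  module Modulus (n : ℕ) where
    M : ℕ
    M = p ^ suc n

    instance
      M≢0 : NonZero M
      M≢0 = m^n≢0 p (suc n)

    open NatMod M
    open IntMod M

    p∣M : p ∣ M
    p∣M = m∣m*n (p ^ n)

    1<M : 1 < M
    1<M = ≤-trans (<⇒≤ 2<p) (m≤m*n p (p ^ n) {{m^n≢0 p n}})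

    1%M≡1 : 1 % M ≡ 1
    1%M≡1 = m<n⇒m%n≡m 1<M

    %≡1⇒1+qM : ∀ z → z % M ≡ 1 % M → z ≡ 1 + (z / M) * M
    %≡1⇒1+qM z z≡1 = trans (m≡m%n+[m/n]*n z M) (cong (_+ (z / M) * M) (trans z≡1 1%M≡1))

    M-1 : ℕ
    M-1 = M ∸ 1

    M≡1+M-1 : M ≡ suc M-1
    M≡1+M-1 = sym (m+[n∸m]≡n (<⇒≤ 1<M))

    M-1≋-1 : + M-1 ≋ ℤ.-1ℤ
    M-1≋-1 = ℤ.1ℤ , (begin
      + M-1                                  ≡⟨ m≡-1+1[1+m] (+ M-1) ⟩
      ℤ.-1ℤ ℤ.+ ℤ.1ℤ ℤ.* (+ 1 ℤ.+ + M-1)     ≡⟨ cong (λ u → ℤ.-1ℤ ℤ.+ ℤ.1ℤ ℤ.* u) (ℤP.pos-+ 1 M-1) ⟨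
      ℤ.-1ℤ ℤ.+ ℤ.1ℤ ℤ.* + suc M-1           ≡⟨ cong (λ m → ℤ.-1ℤ ℤ.+ ℤ.1ℤ ℤ.* + m) M≡1+M-1 ⟨
      ℤ.-1ℤ ℤ.+ ℤ.1ℤ ℤ.* + M                 ∎)
      where
        open ≡-Reasoning
        m≡-1+1[1+m] : ∀ m → m ≡ ℤ.-1ℤ ℤ.+ ℤ.1ℤ ℤ.* (+ 1 ℤ.+ m)
        m≡-1+1[1+m] = ℤ-solve-∀

    integer-inverse : ∀ {x} → ¬ p ∣ x → Σ ℤ λ c → + x ℤ.* c ≋ + 1
    integer-inverse {x} p∤x with coprime-Bézout (coprime-p^ (suc n) p∤x)
    ... | Bézout.+- a y 1+yM≡ax = + a , (+ y , (begin
      + x ℤ.* + a       ≡⟨ ℤP.pos-* x a ⟨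
      + (x * a)         ≡⟨ cong +_ (trans (*-comm x a) (sym 1+yM≡ax)) ⟩
      + (1 + y * M)     ≡⟨ pos-+* 1 y M ⟩
      + 1 ℤ.+ + y ℤ.* + M ∎))
      where open ≡-Reasoning
    ... | Bézout.-+ a y 1+ax≡yM = ℤ.- + a , (ℤ.- + y , (begin
      + x ℤ.* ℤ.- + a                        ≡⟨ x[-a]≡1-[1+ax] (+ x) (+ a) ⟩
      + 1 ℤ.- (+ 1 ℤ.+ + a ℤ.* + x)          ≡⟨ cong (λ u → + 1 ℤ.- u) (trans (sym (pos-+* 1 a x)) (cong +_ 1+ax≡yM)) ⟩
      + 1 ℤ.- + (y * M)                      ≡⟨ cong (λ u → + 1 ℤ.- u) (ℤP.pos-* y M) ⟩
      + 1 ℤ.- + y ℤ.* + M                    ≡⟨ 1-ym≡1+[-y]m (+ y) (+ M) ⟩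
      + 1 ℤ.+ ℤ.- + y ℤ.* + M                ∎))
      where
        open ≡-Reasoning
        x[-a]≡1-[1+ax] : ∀ x a → x ℤ.* ℤ.- a ≡ + 1 ℤ.- (+ 1 ℤ.+ a ℤ.* x)
        x[-a]≡1-[1+ax] = ℤ-solve-∀
        1-ym≡1+[-y]m : ∀ y m → + 1 ℤ.- y ℤ.* m ≡ + 1 ℤ.+ ℤ.- y ℤ.* m
        1-ym≡1+[-y]m = ℤ-solve-∀

    inverse : ∀ {x} → ¬ p ∣ x → Σ ℕ λ v → v < M × (x * v) % M ≡ 1 % M
    inverse {x} p∤x with integer-inverse p∤x
    ... | c , xc≋1 = c ℤ.%ℕ M , ℤ.n%ℕd<d c M , ≋⇒% (begin
      + (x * (c ℤ.%ℕ M))   ≡⟨ ℤP.pos-* x (c ℤ.%ℕ M) ⟩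
      + x ℤ.* + (c ℤ.%ℕ M) ≈⟨ ≋-* (≋-refl {+ x}) (≋-sym (≋-%ℕ c)) ⟩
      + x ℤ.* c            ≈⟨ xc≋1 ⟩
      + 1                  ∎)
      where open SetoidReasoning ≋-setoid

    -- the inverse below M of a unit (multiples of p are sent to 0, unused)
    σ : ℕ → ℕ
    σ x with p ∣? x
    ... | yes _ = 0
    ... | no p∤x = proj₁ (inverse p∤x)

    σ-inverse : ∀ {x} → ¬ p ∣ x → σ x < M × (x * σ x) % M ≡ 1 % M
    σ-inverse {x} p∤x with p ∣? x
    ... | yes p∣x = ⊥-elim (p∤x p∣x)
    ... | no p∤x' = proj₂ (inverse p∤x')

    inverse-unique : ∀ {x y y'} → y < M → y' < M →
                     (x * y) % M ≡ 1 % M → (x * y') % M ≡ 1 % M → y ≡ y'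
    inverse-unique {x} {y} {y'} y<M y'<M xy≡1 xy'≡1 = begin
      y                  ≡⟨ m<n⇒m%n≡m y<M ⟨
      y % M              ≡⟨ cong (_% M) (*-identityʳ y) ⟨
      (y * 1) % M        ≡⟨ *-cong-% {y} {y} refl (sym xy'≡1) ⟩
      (y * (x * y')) % M ≡⟨ cong (_% M) (y[xy']≡[xy]y' y x y') ⟩
      (x * y * y') % M   ≡⟨ *-cong-% xy≡1 refl ⟩
      (1 * y') % M       ≡⟨ cong (_% M) (*-identityˡ y') ⟩
      y' % M             ≡⟨ m<n⇒m%n≡m y'<M ⟩
      y'                 ∎
      where
        open ≡-Reasoning
        y[xy']≡[xy]y' : ∀ y x y' → y * (x * y') ≡ x * y * y'
        y[xy']≡[xy]y' = solve-∀

    square≡1⇒M∣ : ∀ y → (suc y * suc y) % M ≡ 1 % M → M ∣ y * (y + 2)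
    square≡1⇒M∣ y sq≡1 = divides ((suc y * suc y) / M)
      (+-cancelˡ-≡ 1 _ _ (trans (square≡1+y[y+2] y) (%≡1⇒1+qM (suc y * suc y) sq≡1)))
      where
        square≡1+y[y+2] : ∀ y → 1 + y * (y + 2) ≡ suc y * suc y
        square≡1+y[y+2] = solve-∀

    -- the square roots of 1 modulo M below M are 1 and M - 1 (here p is odd)
    sqrt-1 : ∀ y → suc y < M → (suc y * suc y) % M ≡ 1 % M → y ≡ 0 ⊎ suc (suc y) ≡ M
    sqrt-1 y 1+y<M sq≡1 with p ∣? (y + 2)
    ... | no p∤y+2 = inj₁ (trans (sym (m<n⇒m%n≡m y<M)) (n∣m⇒m%n≡0 y M M∣y))
      where
        y<M = <-trans (n<1+n y) 1+y<M
        M∣y = p^∣-cancel {suc n} (square≡1⇒M∣ y sq≡1) p∤y+2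
    ... | yes p∣y+2 = inj₂ (≤-antisym 1+y<M (∣⇒≤ (subst (M ∣_) (+-comm y 2) M∣y+2)))
      where
        p∤y : ¬ p ∣ y
        p∤y p∣y = p∤2 (∣m+n∣m⇒∣n p∣y+2 p∣y)
        M∣y+2 : M ∣ y + 2
        M∣y+2 = p^∣-cancel {suc n} (subst (M ∣_) (*-comm y (y + 2)) (square≡1⇒M∣ y sq≡1)) p∤y

    sqrt-1-below : ∀ x → x ≢ 0 → x < M-1 → (x * x) % M ≡ 1 % M → x ≡ 1
    sqrt-1-below zero x≢0 _ _ = ⊥-elim (x≢0 refl)
    sqrt-1-below (suc y) _ 1+y<M-1 sq≡1
      with sqrt-1 y (subst (suc y <_) (sym M≡1+M-1) (m<n⇒m<1+n 1+y<M-1)) sq≡1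
    ... | inj₁ refl = refl
    ... | inj₂ 2+y≡M = ⊥-elim (<-irrefl (suc-injective (trans 2+y≡M M≡1+M-1)) 1+y<M-1)

    σ-unit : ∀ {x} → IsUnit x → x < M-1 → IsUnit (σ x) × σ x < M-1
    σ-unit {x} (_ , p∤x) x<M-1 = (σx≢0 , p∤σx) , ≤∧≢⇒< (s≤s⁻¹ (subst (σ x <_) M≡1+M-1 σx<M)) σx≢M-1
      where
        σx<M = proj₁ (σ-inverse p∤x)
        x·σx≡1 = proj₂ (σ-inverse p∤x)

        σx≢0 : σ x ≢ 0
        σx≢0 σx≡0 = 0≢1+n (begin
          0             ≡⟨ m*n%n≡0 0 M ⟨
          0 % M         ≡⟨ cong (_% M) (*-zeroʳ x) ⟨
          (x * 0) % M   ≡⟨ cong (λ v → (x * v) % M) σx≡0 ⟨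
          (x * σ x) % M ≡⟨ x·σx≡1 ⟩
          1 % M         ≡⟨ 1%M≡1 ⟩
          1             ∎)
          where open ≡-Reasoning

        -- x σ x = 1 + q M is prime to p
        p∤σx : ¬ p ∣ σ x
        p∤σx p∣σx = p∤1 (∣m+n∣m⇒∣n (subst (p ∣_) x·σx≡qM+1 (∣n⇒∣m*n x p∣σx))
                                    (∣n⇒∣m*n ((x * σ x) / M) p∣M))
          where x·σx≡qM+1 = trans (%≡1⇒1+qM (x * σ x) x·σx≡1) (+-comm 1 _)

        -- x (M - 1) ≡ -x, which is not 1 since 1 + x < M
        σx≢M-1 : σ x ≢ M-1
        σx≢M-1 σx≡M-1 = 0≢1+n (begin
          0                     ≡⟨ m*n%n≡0 x M ⟨
          (x * M) % M           ≡⟨ cong (λ m → (x * m) % M) M≡1+M-1 ⟩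
          (x * suc M-1) % M     ≡⟨ cong (_% M) (trans (*-suc x M-1) (+-comm x (x * M-1))) ⟩
          (x * M-1 + x) % M     ≡⟨ +-cong-% {x * M-1} {1} (subst (λ v → (x * v) % M ≡ 1 % M) σx≡M-1 x·σx≡1) refl ⟩
          (1 + x) % M           ≡⟨ m<n⇒m%n≡m (subst (suc x <_) (sym M≡1+M-1) (s≤s x<M-1)) ⟩
          suc x                 ∎)
          where open ≡-Reasoning

    -- The units below M - 1 are paired by σ (M - 1 itself is its own inverse).
    paired : ∀ {x} → x ∈ units M-1 → Pairing.PairedIn M σ (units M-1) x
    paired {x} x∈units = record
      { partner∈   = ∈-units⁺ (proj₁ σx-unit) (proj₂ σx-unit)
      ; involutive = inverse-unique {σ x} (proj₁ (σ-inverse p∤σx)) x<M (proj₂ (σ-inverse p∤σx))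
                       (trans (cong (_% M) (*-comm (σ x) x)) x·σx≡1)
      ; inverse    = x·σx≡1
      ; fixed⇒1    = λ σx≡x → sqrt-1-below x (proj₁ x-unit) x<M-1
                                (subst (λ v → (x * v) % M ≡ 1 % M) σx≡x x·σx≡1)
      }
      where
        x-unit = proj₁ (∈-units⁻ {m = M-1} x∈units)
        x<M-1 = proj₂ (∈-units⁻ {m = M-1} x∈units)
        x<M = subst (x <_) (sym M≡1+M-1) (m<n⇒m<1+n x<M-1)
        x·σx≡1 = proj₂ (σ-inverse (proj₂ x-unit))
        σx-unit = σ-unit x-unit x<M-1
        p∤σx = proj₂ (proj₁ σx-unit)

    M-1-unit : IsUnit M-1
    M-1-unit = (λ M-1≡0 → <-irrefl (cong suc (sym M-1≡0)) (subst (1 <_) M≡1+M-1 1<M))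
             , (λ p∣M-1 → p∤1 (∣m+n∣m⇒∣n (subst (p ∣_) (trans M≡1+M-1 (+-comm 1 M-1)) p∣M) p∣M-1))

    wilson : + U M ≋ ℤ.-1ℤ
    wilson = begin
      + U M                  ≡⟨ cong (+_ ∘ U) M≡1+M-1 ⟩
      + U (suc M-1)          ≡⟨ cong +_ (U-unit M-1-unit) ⟩
      + (M-1 * U M-1)        ≡⟨ ℤP.pos-* M-1 (U M-1) ⟩
      + M-1 ℤ.* + U M-1      ≈⟨ ≋-* M-1≋-1 (%⇒≋ U[M-1]≡1) ⟩
      ℤ.-1ℤ ℤ.* + 1          ≡⟨⟩
      ℤ.-1ℤ                  ∎
      where
        open SetoidReasoning ≋-setoid
        U[M-1]≡1 : U M-1 % M ≡ 1 % M
        U[M-1]≡1 = Pairing.pairing M σ _ (units M-1) ≤-refl (units-unique M-1) paired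

    unit-+M : ∀ {m} → IsUnit m → IsUnit (m + M)
    unit-+M {m} (m≢0 , p∤m) = (λ m+M≡0 → m≢0 (m+n≡0⇒m≡0 m m+M≡0))
                            , (λ p∣m+M → p∤m (∣m+n∣m⇒∣n (subst (p ∣_) (+-comm m M) p∣m+M) p∣M))

    nonunit-+M : ∀ {m} → ¬ IsUnit m → ¬ IsUnit (m + M)
    nonunit-+M {m} nonunit (m+M≢0 , p∤m+M) = nonunit (m≢0 , p∤m)
      where
        m≢0 : m ≢ 0
        m≢0 refl = p∤m+M p∣M
        p∤m : ¬ p ∣ m
        p∤m p∣m = p∤m+M (∣m∣n⇒∣m+n p∣m p∣M)

    -- shifting by M contributes the units in [M, M + m), i.e. U(m) again, and U(M)
    U-shift : ∀ m → + U (m + M) ≋ ℤ.- + U m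
    U-shift zero = wilson
    U-shift (suc m) with isUnit? m
    ... | no nonunit = begin
      + U (suc (m + M))    ≡⟨ cong +_ (U-nonunit (nonunit-+M nonunit)) ⟩
      + U (m + M)          ≈⟨ U-shift m ⟩
      ℤ.- + U m            ≡⟨ cong (ℤ.-_ ∘ +_) (U-nonunit nonunit) ⟨
      ℤ.- + U (suc m)      ∎
      where open SetoidReasoning ≋-setoid
    ... | yes unit = begin
      + U (suc (m + M))              ≡⟨ cong +_ (U-unit (unit-+M unit)) ⟩
      + ((m + M) * U (m + M))        ≡⟨ ℤP.pos-* (m + M) (U (m + M)) ⟩
      + (m + M) ℤ.* + U (m + M)      ≡⟨ cong (ℤ._* + U (m + M)) (ℤP.pos-+ m M) ⟩
      (+ m ℤ.+ + M) ℤ.* + U (m + M)  ≈⟨ ≋-* (≋-+ (≋-refl {+ m}) M≋0) (U-shift m) ⟩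
      (+ m ℤ.+ ℤ.0ℤ) ℤ.* ℤ.- + U m   ≡⟨ a+0*[-b]≡-[ab] (+ m) (+ U m) ⟩
      ℤ.- (+ m ℤ.* + U m)            ≡⟨ cong ℤ.-_ (ℤP.pos-* m (U m)) ⟨
      ℤ.- + (m * U m)                ≡⟨ cong (ℤ.-_ ∘ +_) (U-unit unit) ⟨
      ℤ.- + U (suc m)                ∎
      where
        open SetoidReasoning ≋-setoid
        a+0*[-b]≡-[ab] : ∀ a b → (a ℤ.+ ℤ.0ℤ) ℤ.* ℤ.- b ≡ ℤ.- (a ℤ.* b)
        a+0*[-b]≡-[ab] = ℤ-solve-∀

    sign-M : sign M ≡ ℤ.-1ℤ
    sign-M = cong (λ b → if b then ℤ.1ℤ else ℤ.-1ℤ) (p^-odd (suc n))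

    -- M is odd, so the sign flips as well and Γ is M-periodic modulo M
    Γ-shift : ∀ m → Γℕ (m + M) ≋ Γℕ m
    Γ-shift m = begin
      sign (m + M) ℤ.* + U (m + M)          ≡⟨ cong (ℤ._* + U (m + M)) (sign-+ m M) ⟩
      sign m ℤ.* sign M ℤ.* + U (m + M)     ≡⟨ cong (λ s → sign m ℤ.* s ℤ.* + U (m + M)) sign-M ⟩
      sign m ℤ.* ℤ.-1ℤ ℤ.* + U (m + M)      ≈⟨ ≋-* (≋-refl {sign m ℤ.* ℤ.-1ℤ}) (U-shift m) ⟩
      sign m ℤ.* ℤ.-1ℤ ℤ.* ℤ.- + U m        ≡⟨ s[-1][-u]≡su (sign m) (+ U m) ⟩
      sign m ℤ.* + U m                      ∎
      where
        open SetoidReasoning ≋-setoid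
        s[-1][-u]≡su : ∀ s u → s ℤ.* ℤ.-1ℤ ℤ.* ℤ.- u ≡ s ℤ.* u
        s[-1][-u]≡su = ℤ-solve-∀

    Γ-shift* : ∀ m q → Γℕ (m + q * M) ≋ Γℕ m
    Γ-shift* m zero = ≋-reflexive (cong Γℕ (+-identityʳ m))
    Γ-shift* m (suc q) = begin
      Γℕ (m + (M + q * M)) ≡⟨ cong Γℕ (m+[M+qM]≡[m+qM]+M m q M) ⟩
      Γℕ (m + q * M + M)   ≈⟨ Γ-shift (m + q * M) ⟩
      Γℕ (m + q * M)       ≈⟨ Γ-shift* m q ⟩
      Γℕ m                 ∎
      where
        open SetoidReasoning ≋-setoid
        m+[M+qM]≡[m+qM]+M : ∀ m q M → m + (M + q * M) ≡ m + q * M + M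
        m+[M+qM]≡[m+qM]+M = solve-∀

    Γ-% : ∀ m → Γℕ (m % M) ≋ Γℕ m
    Γ-% m = ≋-sym (begin
      Γℕ m                     ≡⟨ cong Γℕ (m≡m%n+[m/n]*n m M) ⟩
      Γℕ (m % M + (m / M) * M) ≈⟨ Γ-shift* (m % M) (m / M) ⟩
      Γℕ (m % M)               ∎)
      where open SetoidReasoning ≋-setoid

  pochℕ : ℕ → ℕ → ℕ
  pochℕ x zero = 1
  pochℕ x (suc k) = pochℕ x k * (x + k)

  multiplesProduct : ℕ → ℕ → ℕ
  multiplesProduct R zero = 1
  multiplesProduct R (suc k) with p ∣? (R + k)
  ... | yes _ = multiplesProduct R k * (R + k)
  ... | no _ = multiplesProduct R k

  multiplesProduct-multiple : ∀ {R k} → p ∣ R + k → multiplesProduct R (suc k) ≡ multiplesProduct R k * (R + k)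
  multiplesProduct-multiple {R} {k} p∣R+k with p ∣? (R + k)
  ... | yes _ = refl
  ... | no p∤R+k = ⊥-elim (p∤R+k p∣R+k)

  multiplesProduct-other : ∀ {R k} → ¬ p ∣ R + k → multiplesProduct R (suc k) ≡ multiplesProduct R k
  multiplesProduct-other {R} {k} p∤R+k with p ∣? (R + k)
  ... | yes p∣R+k = ⊥-elim (p∤R+k p∣R+k)
  ... | no _ = refl

  split-units : ∀ {R} → R ≢ 0 → ∀ k → pochℕ R k * U R ≡ U (R + k) * multiplesProduct R k
  split-units {R} R≢0 zero = trans (*-identityˡ (U R)) (sym (trans (*-identityʳ _) (cong U (+-identityʳ R))))
  split-units {R} R≢0 (suc k) = step (p ∣? (R + k))
    where
      open ≡-Reasoning
      goal = U (R + suc k) * multiplesProduct R (suc k)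

      step : Dec (p ∣ R + k) → pochℕ R k * (R + k) * U R ≡ goal
      step (yes p∣R+k) = begin
        pochℕ R k * (R + k) * U R                    ≡⟨ xyz≡xzy (pochℕ R k) (R + k) (U R) ⟩
        pochℕ R k * U R * (R + k)                    ≡⟨ cong (_* (R + k)) (split-units R≢0 k) ⟩
        U (R + k) * multiplesProduct R k * (R + k)   ≡⟨ *-assoc (U (R + k)) _ _ ⟩
        U (R + k) * (multiplesProduct R k * (R + k)) ≡⟨ cong₂ _*_ (U-nonunit (λ (_ , p∤R+k) → p∤R+k p∣R+k))
                                                                  (multiplesProduct-multiple p∣R+k) ⟨
        U (suc (R + k)) * multiplesProduct R (suc k) ≡⟨ cong (λ m → U m * multiplesProduct R (suc k)) (+-suc R k) ⟨
        goal                                         ∎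
        where
          xyz≡xzy : ∀ x y z → x * y * z ≡ x * z * y
          xyz≡xzy = solve-∀
      step (no p∤R+k) = begin
        pochℕ R k * (R + k) * U R                    ≡⟨ xyz≡y[xz] (pochℕ R k) (R + k) (U R) ⟩
        (R + k) * (pochℕ R k * U R)                  ≡⟨ cong ((R + k) *_) (split-units R≢0 k) ⟩
        (R + k) * (U (R + k) * multiplesProduct R k) ≡⟨ *-assoc (R + k) _ _ ⟨
        (R + k) * U (R + k) * multiplesProduct R k   ≡⟨ cong₂ _*_ (U-unit (R+k≢0 , p∤R+k)) (multiplesProduct-other p∤R+k) ⟨
        U (suc (R + k)) * multiplesProduct R (suc k) ≡⟨ cong (λ m → U m * multiplesProduct R (suc k)) (+-suc R k) ⟨
        goal                                         ∎
        where
          R+k≢0 : R + k ≢ 0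
          R+k≢0 R+k≡0 = R≢0 (m+n≡0⇒m≡0 R R+k≡0)
          xyz≡y[xz] : ∀ x y z → x * y * z ≡ y * (x * z)
          xyz≡y[xz] = solve-∀

  -- k lies in the window in which [R, R + k) contains exactly the c multiples
  -- R + d, R + d + p, …, R + d + (c - 1) p of p
  InWindow : ℕ → ℕ → ℕ → Set
  InWindow d c k = k ≤ d + p * c × d + p * c < k + p

  -- If R + d = p t is the first multiple of p from R on, the multiples of p in
  -- a window are p t, p (t + 1), …, p (t + c - 1), with product p^c (t)_c.
  module Multiples {R d t : ℕ} (d<p : d < p) (R+d≡pt : R + d ≡ p * t) where

    multiple-at : ∀ c → R + (d + p * c) ≡ p * (t + c)
    multiple-at c = begin
      R + (d + p * c) ≡⟨ +-assoc R d (p * c) ⟨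
      R + d + p * c   ≡⟨ cong (_+ p * c) R+d≡pt ⟩
      p * t + p * c   ≡⟨ *-distribˡ-+ p t c ⟨
      p * (t + c)     ∎
      where open ≡-Reasoning

    not-multiple : ∀ {k c} → k < d + p * c → d + p * c < k + p → ¬ p ∣ R + k
    not-multiple {k} {c} k<d+pc d+pc<k+p p∣R+k = <⇒≱ δ<p (∣⇒≤ {{>-nonZero 0<δ}} p∣δ)
      where
        δ = d + p * c ∸ k
        0<δ : 0 < δ
        0<δ = m<n⇒0<n∸m k<d+pc
        δ<p : δ < p
        δ<p = subst (δ <_) (m+n∸m≡n k p) (∸-monoˡ-< d+pc<k+p (<⇒≤ k<d+pc))
        R+k+δ≡p[t+c] : R + k + δ ≡ p * (t + c)
        R+k+δ≡p[t+c] = trans (trans (+-assoc R k δ) (cong (λ u → R + u) (m+[n∸m]≡n (<⇒≤ k<d+pc)))) (multiple-at c)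
        p∣δ : p ∣ δ
        p∣δ = ∣m+n∣m⇒∣n (subst (p ∣_) (sym R+k+δ≡p[t+c]) (m∣m*n (t + c))) p∣R+k

    multiplesProduct-window : ∀ k c → InWindow d c k → multiplesProduct R k ≡ p ^ c * pochℕ t c
    multiplesProduct-window zero zero _ = refl
    multiplesProduct-window zero (suc c) (_ , d+p[1+c]<p) =
      ⊥-elim (<⇒≱ d+p[1+c]<p (≤-trans (m≤m*n p (suc c)) (m≤n+m (p * suc c) d)))
    multiplesProduct-window (suc k) c (1+k≤d+pc , d+pc<1+k+p) with d + p * c ≟ k + p
    ... | no d+pc≢k+p = begin
      multiplesProduct R (suc k) ≡⟨ multiplesProduct-other (not-multiple 1+k≤d+pc d+pc<k+p) ⟩
      multiplesProduct R k       ≡⟨ multiplesProduct-window k c (≤-trans (n≤1+n k) 1+k≤d+pc , d+pc<k+p) ⟩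
      p ^ c * pochℕ t c          ∎
      where
        open ≡-Reasoning
        d+pc<k+p = ≤∧≢⇒< (s≤s⁻¹ d+pc<1+k+p) d+pc≢k+p
    ... | yes d+pc≡k+p = last-multiple c d+pc≡k+p
      where
        last-multiple : ∀ c → d + p * c ≡ k + p → multiplesProduct R (suc k) ≡ p ^ c * pochℕ t c
        last-multiple zero d+p0≡k+p = ⊥-elim (<⇒≱ d<p (subst (p ≤_) (sym (trans (sym (d+p*0≡d d p)) d+p0≡k+p)) (m≤n+m p k)))
          where
            d+p*0≡d : ∀ d p → d + p * 0 ≡ d
            d+p*0≡d = solve-∀
        last-multiple (suc c) d+p[1+c]≡k+p = begin
          multiplesProduct R (suc k)        ≡⟨ multiplesProduct-multiple p∣R+k ⟩
          multiplesProduct R k * (R + k)    ≡⟨ cong₂ _*_ (multiplesProduct-window k c window) R+k≡p[t+c] ⟩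
          p ^ c * pochℕ t c * (p * (t + c)) ≡⟨ regroup p (p ^ c) (pochℕ t c) (t + c) ⟩
          p * p ^ c * (pochℕ t c * (t + c)) ∎
          where
            open ≡-Reasoning
            k≡d+pc : k ≡ d + p * c
            k≡d+pc = +-cancelʳ-≡ p k (d + p * c) (sym (trans (d+pc+p≡d+p[1+c] d p c) d+p[1+c]≡k+p))
              where
                d+pc+p≡d+p[1+c] : ∀ d p c → d + p * c + p ≡ d + p * suc c
                d+pc+p≡d+p[1+c] = solve-∀
            R+k≡p[t+c] : R + k ≡ p * (t + c)
            R+k≡p[t+c] = trans (cong (λ u → R + u) k≡d+pc) (multiple-at c)
            p∣R+k : p ∣ R + k
            p∣R+k = divides (t + c) (trans R+k≡p[t+c] (*-comm p (t + c)))
            window : InWindow d c k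
            window = ≤-reflexive k≡d+pc , subst (_< k + p) k≡d+pc (m<m+n k (<-trans (s≤s z≤n) 2<p))
            regroup : ∀ p q a s → q * a * (p * s) ≡ p * q * (a * s)
            regroup = solve-∀

  window-low : ∀ {a b d} → a ≤ d → d < p → InWindow d b (a + b * p)
  window-low {a} {b} {d} a≤d d<p = +-mono-≤ a≤d (≤-reflexive (*-comm b p)) , (begin-strict
    d + p * b       <⟨ +-monoˡ-< (p * b) d<p ⟩
    p + p * b       ≡⟨ p+pb≡bp+p p b ⟩
    b * p + p       ≤⟨ m≤n+m (b * p + p) a ⟩
    a + (b * p + p) ≡⟨ +-assoc a (b * p) p ⟨
    a + b * p + p   ∎)
    where
      open ≤-Reasoning
      p+pb≡bp+p : ∀ p b → p + p * b ≡ b * p + p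
      p+pb≡bp+p = solve-∀

  window-high : ∀ {a b d} → d < a → a < p → InWindow d (suc b) (a + b * p)
  window-high {a} {b} {d} d<a a<p = (begin
    a + b * p       ≤⟨ +-monoˡ-≤ (b * p) (<⇒≤ a<p) ⟩
    p + b * p       ≤⟨ m≤n+m (p + b * p) d ⟩
    d + (p + b * p) ≡⟨ d+[p+bp]≡d+p[1+b] d p b ⟩
    d + p * suc b   ∎) , (begin-strict
    d + p * suc b   ≡⟨ d+[p+bp]≡d+p[1+b] d p b ⟨
    d + (p + b * p) <⟨ +-monoˡ-< (p + b * p) d<a ⟩
    a + (p + b * p) ≡⟨ a+[p+bp]≡a+bp+p a p b ⟩
    a + b * p + p   ∎)
    where
      open ≤-Reasoning
      d+[p+bp]≡d+p[1+b] : ∀ d p b → d + (p + b * p) ≡ d + p * suc b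
      d+[p+bp]≡d+p[1+b] = solve-∀
      a+[p+bp]≡a+bp+p : ∀ a p b → a + (p + b * p) ≡ a + b * p + p
      a+[p+bp]≡a+bp+p = solve-∀

  ν-low : ∀ {a d} → a ≤ d → ν a d ≡ 0
  ν-low {a} {d} a≤d = cong (λ b → if b then 0 else 1) (dec-true (a ≤? d) a≤d)

  ν-high : ∀ {a d} → ¬ a ≤ d → ν a d ≡ 1
  ν-high {a} {d} a≰d = cong (λ b → if b then 0 else 1) (dec-false (a ≤? d) a≰d)

  -- the first multiple of p from R on: R + (p - R mod p) = p (⌊R/p⌋ + 1)
  round-up : ∀ R → R + (p ∸ R % p) ≡ p * (R / p + 1)
  round-up R = begin
    R + (p ∸ R % p)                     ≡⟨ cong (_+ (p ∸ R % p)) (m≡m%n+[m/n]*n R p) ⟩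
    R % p + R / p * p + (p ∸ R % p)     ≡⟨ x+y+z≡y+[x+z] (R % p) (R / p * p) (p ∸ R % p) ⟩
    R / p * p + (R % p + (p ∸ R % p))   ≡⟨ cong (λ u → R / p * p + u) (m+[n∸m]≡n (<⇒≤ (m%n<n R p))) ⟩
    R / p * p + p                       ≡⟨ qp+p≡p[q+1] (R / p) p ⟩
    p * (R / p + 1)                     ∎
    where
      open ≡-Reasoning
      x+y+z≡y+[x+z] : ∀ x y z → x + y + z ≡ y + (x + z)
      x+y+z≡y+[x+z] = solve-∀
      qp+p≡p[q+1] : ∀ q p → q * p + p ≡ p * (q + 1)
      qp+p≡p[q+1] = solve-∀

  module ExactIdentity (R k : ℕ) (p∤R : ¬ p ∣ R) where
    a b d t : ℕ
    a = k % p
    b = k / p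
    d = p ∸ R % p
    t = R / p + 1

    k≡a+bp : k ≡ a + b * p
    k≡a+bp = m≡m%n+[m/n]*n k p

    a<p : a < p
    a<p = m%n<n k p

    d<p : d < p
    d<p = ∸-monoʳ-< (n≢0⇒n>0 (λ R%p≡0 → p∤R (m%n≡0⇒n∣m R p R%p≡0))) (<⇒≤ (m%n<n R p))

    multiples-from-1 : multiplesProduct 1 k ≡ p ^ b * pochℕ 1 b
    multiples-from-1 = trans (cong (multiplesProduct 1) k≡a+bp)
      (Multiples.multiplesProduct-window pred[p]<p 1+pred[p]≡p*1 (a + b * p) b
         (window-low (<⇒≤pred a<p) pred[p]<p))
      where
        pred[p]<p : pred p < p
        pred[p]<p = ≤-reflexive (suc-pred p)
        1+pred[p]≡p*1 : 1 + pred p ≡ p * 1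
        1+pred[p]≡p*1 = trans (suc-pred p) (sym (*-identityʳ p))

    window-product : ∀ {c} → InWindow d c (a + b * p) → multiplesProduct R (a + b * p) ≡ p ^ c * pochℕ t c
    window-product = Multiples.multiplesProduct-window d<p (round-up R) (a + b * p) _

    multiples-from-R : multiplesProduct R k ≡ p ^ b * pochℕ t b * ((t + b) * p) ^ ν a d
    multiples-from-R with a ≤? d
    ... | yes a≤d = begin
      multiplesProduct R k               ≡⟨ cong (multiplesProduct R) k≡a+bp ⟩
      multiplesProduct R (a + b * p)     ≡⟨ window-product (window-low {a} {b} a≤d d<p) ⟩
      p ^ b * pochℕ t b                  ≡⟨ *-identityʳ _ ⟨
      p ^ b * pochℕ t b * 1              ≡⟨ cong (λ e → p ^ b * pochℕ t b * ((t + b) * p) ^ e) (ν-low a≤d) ⟨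
      p ^ b * pochℕ t b * ((t + b) * p) ^ ν a d ∎
      where open ≡-Reasoning
    ... | no a≰d = begin
      multiplesProduct R k                  ≡⟨ cong (multiplesProduct R) k≡a+bp ⟩
      multiplesProduct R (a + b * p)        ≡⟨ window-product (window-high {a} {b} (≰⇒> a≰d) a<p) ⟩
      p * p ^ b * (pochℕ t b * (t + b))     ≡⟨ regroup p (p ^ b) (pochℕ t b) (t + b) ⟩
      p ^ b * pochℕ t b * ((t + b) * p) ^ 1 ≡⟨ cong (λ e → p ^ b * pochℕ t b * ((t + b) * p) ^ e) (ν-high a≰d) ⟨
      p ^ b * pochℕ t b * ((t + b) * p) ^ ν a d ∎
      where
        open ≡-Reasoning
        regroup : ∀ p q T s → p * q * (T * s) ≡ q * T * ((s * p) * 1)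
        regroup = solve-∀

    poch-1 : pochℕ 1 k ≡ U (1 + k) * (p ^ b * pochℕ 1 b)
    poch-1 = trans (sym (*-identityʳ (pochℕ 1 k)))
                   (trans (split-units (λ ()) k) (cong (U (1 + k) *_) multiples-from-1))

    exact-identity : pochℕ R k * U R * U (1 + k) * pochℕ 1 b ≡
                     U (R + k) * pochℕ 1 k * pochℕ t b * ((t + b) * p) ^ ν a d
    exact-identity = begin
      pochℕ R k * U R * U (1 + k) * pochℕ 1 b
        ≡⟨ cong (λ x → x * U (1 + k) * pochℕ 1 b) (split-units R≢0 k) ⟩
      U (R + k) * multiplesProduct R k * U (1 + k) * pochℕ 1 b
        ≡⟨ cong (λ x → U (R + k) * x * U (1 + k) * pochℕ 1 b) multiples-from-R ⟩
      U (R + k) * (p ^ b * pochℕ t b * W) * U (1 + k) * pochℕ 1 b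
        ≡⟨ rearrange (U (R + k)) (p ^ b) (pochℕ t b) W (U (1 + k)) (pochℕ 1 b) ⟩
      U (R + k) * (U (1 + k) * (p ^ b * pochℕ 1 b)) * pochℕ t b * W
        ≡⟨ cong (λ x → U (R + k) * x * pochℕ t b * W) poch-1 ⟨
      U (R + k) * pochℕ 1 k * pochℕ t b * W ∎
      where
        open ≡-Reasoning
        W = ((t + b) * p) ^ ν a d
        R≢0 : R ≢ 0
        R≢0 refl = p∤R (p ∣0)
        rearrange : ∀ u q T W v B → u * (q * T * W) * v * B ≡ u * (v * (q * B)) * T * W
        rearrange = solve-∀

  module Evaluation (n : ℕ) where
    open Modulus n
    open IntMod M

    ℓ : ℕ
    ℓ = suc n

    infix 4 _represents_
    _represents_ : Seq → ℤ → Set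
    x represents u = + (x ℓ) ≋ u

    ι-rep : ∀ m → ι m represents + m
    ι-rep = ≋-%

    ⊕-rep : ∀ {x y u v} → x represents u → y represents v → (x ⊕ y) represents u ℤ.+ v
    ⊕-rep {x} {y} x~u y~v = begin
      + ((x ℓ + y ℓ) % M)   ≈⟨ ≋-% (x ℓ + y ℓ) ⟩
      + (x ℓ + y ℓ)         ≡⟨ ℤP.pos-+ (x ℓ) (y ℓ) ⟩
      + x ℓ ℤ.+ + y ℓ       ≈⟨ ≋-+ x~u y~v ⟩
      _                     ∎
      where open SetoidReasoning ≋-setoid

    ⊗-rep : ∀ {x y u v} → x represents u → y represents v → (x ⊗ y) represents u ℤ.* v
    ⊗-rep {x} {y} x~u y~v = begin
      + ((x ℓ * y ℓ) % M)   ≈⟨ ≋-% (x ℓ * y ℓ) ⟩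
      + (x ℓ * y ℓ)         ≡⟨ ℤP.pos-* (x ℓ) (y ℓ) ⟩
      + x ℓ ℤ.* + y ℓ       ≈⟨ ≋-* x~u y~v ⟩
      _                     ∎
      where open SetoidReasoning ≋-setoid

    ⊖-rep : ∀ {x u} → x represents u → (⊖ x) represents ℤ.- u
    ⊖-rep {x} x~u = begin
      + ((M ∸ x ℓ % M) % M) ≈⟨ ≋-% (M ∸ x ℓ % M) ⟩
      + (M ∸ x ℓ % M)       ≈⟨ M-e≋-e (m%n≤n (x ℓ) M) ⟩
      ℤ.- + (x ℓ % M)       ≈⟨ ≋-neg (≋-trans (≋-% (x ℓ)) x~u) ⟩
      _                     ∎
      where open SetoidReasoning ≋-setoid

    pochℤ : ℤ → ℕ → ℤ
    pochℤ u zero = ℤ.1ℤ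
    pochℤ u (suc k) = pochℤ u k ℤ.* (u ℤ.+ + k)

    powℤ : ℤ → ℕ → ℤ
    powℤ u zero = ℤ.1ℤ
    powℤ u (suc e) = u ℤ.* powℤ u e

    pochℤ-pos : ∀ a k → pochℤ (+ a) k ≡ + pochℕ a k
    pochℤ-pos a zero = refl
    pochℤ-pos a (suc k) = trans (cong₂ ℤ._*_ (pochℤ-pos a k) (sym (ℤP.pos-+ a k))) (sym (ℤP.pos-* (pochℕ a k) (a + k)))

    powℤ-pos : ∀ a e → powℤ (+ a) e ≡ + (a ^ e)
    powℤ-pos a zero = refl
    powℤ-pos a (suc e) = trans (cong (ℤ._*_ (+ a)) (powℤ-pos a e)) (sym (ℤP.pos-* a (a ^ e)))

    poch-rep : ∀ {x u} → x represents u → ∀ k → poch x k represents pochℤ u k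
    poch-rep x~u zero = ι-rep 1
    poch-rep {x} x~u (suc k) = ⊗-rep {poch x k} {x ⊕ ι k} (poch-rep x~u k) (⊕-rep {x} {ι k} x~u (ι-rep k))

    pow-rep : ∀ {x u} → x represents u → ∀ e → pow x e represents powℤ u e
    pow-rep x~u zero = ι-rep 1
    pow-rep {x} x~u (suc e) = ⊗-rep {x} {pow x e} x~u (pow-rep x~u e)

    prodUnits-unit : ∀ {j} → IsUnit j → prodUnits ℓ (suc j) ≡ (prodUnits ℓ j * j) % M
    prodUnits-unit {zero} (0≢0 , _) = ⊥-elim (0≢0 refl)
    prodUnits-unit {suc j} (_ , p∤j) with p ∣? suc j
    ... | yes p∣j = ⊥-elim (p∤j p∣j)
    ... | no _ = refl

    prodUnits-nonunit : ∀ {j} → ¬ IsUnit j → prodUnits ℓ (suc j) ≡ prodUnits ℓ j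
    prodUnits-nonunit {zero} _ = refl
    prodUnits-nonunit {suc j} nonunit with p ∣? suc j
    ... | yes _ = refl
    ... | no p∤j = ⊥-elim (nonunit ((λ ()) , p∤j))

    prodUnits-rep : ∀ m → + (prodUnits ℓ m) ≋ + U m
    prodUnits-rep zero = ≋-% 1
    prodUnits-rep (suc j) with isUnit? j
    ... | no nonunit = begin
      + prodUnits ℓ (suc j) ≡⟨ cong +_ (prodUnits-nonunit nonunit) ⟩
      + prodUnits ℓ j       ≈⟨ prodUnits-rep j ⟩
      + U j                 ≡⟨ cong +_ (U-nonunit nonunit) ⟨
      + U (suc j)           ∎
      where open SetoidReasoning ≋-setoid
    ... | yes unit = begin
      + prodUnits ℓ (suc j)          ≡⟨ cong +_ (prodUnits-unit unit) ⟩
      + ((prodUnits ℓ j * j) % M)    ≈⟨ ≋-% (prodUnits ℓ j * j) ⟩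
      + (prodUnits ℓ j * j)          ≡⟨ ℤP.pos-* (prodUnits ℓ j) j ⟩
      + prodUnits ℓ j ℤ.* + j        ≈⟨ ≋-* (prodUnits-rep j) (≋-refl {+ j}) ⟩
      + U j ℤ.* + j                  ≡⟨ ℤP.pos-* (U j) j ⟨
      + (U j * j)                    ≡⟨ cong +_ (trans (*-comm (U j) j) (sym (U-unit unit))) ⟩
      + U (suc j)                    ∎
      where open SetoidReasoning ≋-setoid

    prodUnits<M : ∀ m → prodUnits ℓ m < M
    prodUnits<M zero = m%n<n 1 M
    prodUnits<M (suc j) with isUnit? j
    ... | no nonunit = subst (_< M) (sym (prodUnits-nonunit nonunit)) (prodUnits<M j)
    ... | yes unit = subst (_< M) (sym (prodUnits-unit unit)) (m%n<n (prodUnits ℓ j * j) M)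

    Γp-residue : ∀ m → + (if isEven m then prodUnits ℓ m else (M ∸ prodUnits ℓ m) % M) ≋ Γℕ m
    Γp-residue m with isEven m
    ... | true = ≋-trans (prodUnits-rep m) (≋-reflexive (sym (ℤP.*-identityˡ (+ U m))))
    ... | false = begin
      + ((M ∸ prodUnits ℓ m) % M) ≈⟨ ≋-% (M ∸ prodUnits ℓ m) ⟩
      + (M ∸ prodUnits ℓ m)       ≈⟨ M-e≋-e (<⇒≤ (prodUnits<M m)) ⟩
      ℤ.- + prodUnits ℓ m         ≈⟨ ≋-neg (prodUnits-rep m) ⟩
      ℤ.- + U m                   ≡⟨ ℤP.-1*i≡-i (+ U m) ⟨
      ℤ.-1ℤ ℤ.* + U m             ∎
      where open SetoidReasoning ≋-setoid

    Γp-rep : ∀ {x a} → x represents + a → Γp x represents Γℕ a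
    Γp-rep {x} {a} x~a = begin
      + Γp x ℓ          ≈⟨ Γp-residue (x ℓ % M) ⟩
      Γℕ (x ℓ % M)      ≡⟨ cong Γℕ (≋⇒% x~a) ⟩
      Γℕ (a % M)        ≈⟨ Γ-% a ⟩
      Γℕ a              ∎
      where open SetoidReasoning ≋-setoid

  module UnitDigits (r : Seq) (r∈ℤp : IsZp r) (digit≢0 : digit0 r ≢ 0) where

    instance
      p^1≢0 : NonZero (p ^ 1)
      p^1≢0 = m^n≢0 p 1

    %p^1≡%p : ∀ x → x % (p ^ 1) ≡ x % p
    %p^1≡%p x = %-cong-modulus x (*-identityʳ p)

    first-digit : ∀ j → r (suc j) % p ≡ digit0 r
    first-digit zero = sym (%p^1≡%p (r 1))
    first-digit (suc j) = begin
      r (suc (suc j)) % p                ≡⟨ m∣n⇒o%n%m≡o%m p (p ^ suc j) (r (suc (suc j))) (m∣m*n (p ^ j)) ⟨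
      r (suc (suc j)) % (p ^ suc j) % p  ≡⟨ cong (_% p) (proj₂ (r∈ℤp (suc j))) ⟩
      r (suc j) % p                      ≡⟨ first-digit j ⟩
      digit0 r                           ∎
      where
        open ≡-Reasoning
        instance
          p^[1+j]≢0 : NonZero (p ^ suc j)
          p^[1+j]≢0 = m^n≢0 p (suc j)

    p∤r : ∀ j → ¬ p ∣ r (suc j)
    p∤r j p∣r = digit≢0 (trans (sym (first-digit j)) (n∣m⇒m%n≡0 (r (suc j)) p p∣r))

    -- [-r]_0 = p - [r]_0, since [r]_0 ≠ 0
    digit-neg : ∀ j → digit0 (⊖ r) ≡ p ∸ r (suc j) % p
    digit-neg j = begin
      ((p ^ 1 ∸ r 1 % p ^ 1) % p ^ 1) % p ^ 1 ≡⟨ %p^1≡%p _ ⟩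
      ((p ^ 1 ∸ r 1 % p ^ 1) % p ^ 1) % p     ≡⟨ cong (_% p) (%p^1≡%p _) ⟩
      ((p ^ 1 ∸ r 1 % p ^ 1) % p) % p         ≡⟨ m%n%n≡m%n _ p ⟩
      (p ^ 1 ∸ r 1 % p ^ 1) % p               ≡⟨ cong₂ (λ q e → (q ∸ e) % p) (*-identityʳ p) (sym (first-digit j)) ⟩
      (p ∸ r (suc j) % p) % p                 ≡⟨ m<n⇒m%n≡m p-r%p<p ⟩
      p ∸ r (suc j) % p                       ∎
      where
        open ≡-Reasoning
        r%p≢0 : r (suc j) % p ≢ 0
        r%p≢0 r%p≡0 = p∤r j (m%n≡0⇒n∣m (r (suc j)) p r%p≡0)
        p-r%p<p = ∸-monoʳ-< (n≢0⇒n>0 r%p≢0) (<⇒≤ (m%n<n (r (suc j)) p))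

  lhs : Seq → ℕ → Seq
  lhs r k = poch r k ⊗ (Γp (ι (1 + k)) ⊗ (Γp r ⊗ poch (ι 1) (k / p)))

  rhs : Seq → ℕ → Seq
  rhs r k = ⊖ (Γp (r ⊕ ι k) ⊗ (poch (ι 1) k ⊗ (poch (dash r) (k / p)
              ⊗ pow ((dash r ⊕ ι (k / p)) ⊗ ι p) (ν (k % p) (digit0 (⊖ r))))))

  -- The lemma at level n + 1, for the unit r represented by R = r(n + 2).
  module LevelIdentity (n : ℕ) (r : Seq) (r∈ℤp : IsZp r) (digit≢0 : digit0 r ≢ 0) (k : ℕ) where
    open Modulus n
    open IntMod M
    open Evaluation n
    open UnitDigits r r∈ℤp digit≢0

    R : ℕ
    R = r (suc ℓ)

    open ExactIdentity R k (p∤r ℓ)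

    W : ℕ
    W = ((t + b) * p) ^ ν a d

    r-rep : r represents + R
    r-rep = ≋-trans (≋-reflexive (cong +_ (sym (proj₂ (r∈ℤp ℓ))))) (≋-% R)

    dash-rep : dash r represents + t
    dash-rep = ≋-trans (≋-reflexive (cong +_ dash≡t%M)) (≋-% t)
      where
        instance
          pM≢0 : NonZero (p * M)
          pM≢0 = m^n≢0 p (suc ℓ)
          Mp≢0 : NonZero (M * p)
          Mp≢0 = m*n≢0 M p
        dash≡t%M : dash r ℓ ≡ t % M
        dash≡t%M = begin
          ((R + digit0 (⊖ r)) % (p * M)) / p ≡⟨ cong (λ e → ((R + e) % (p * M)) / p) (digit-neg ℓ) ⟩
          ((R + d) % (p * M)) / p            ≡⟨ cong (λ x → (x % (p * M)) / p) (trans (round-up R) (*-comm p t)) ⟩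
          ((t * p) % (p * M)) / p            ≡⟨ cong (_/ p) (%-cong-modulus (t * p) (*-comm p M)) ⟩
          ((t * p) % (M * p)) / p            ≡⟨ cong (_/ p) (m%n*o≡m*o%[n*o] t M p) ⟨
          (t % M * p) / p                    ≡⟨ m*n/n≡m (t % M) p ⟩
          t % M                              ∎
          where open ≡-Reasoning

    lhs-rep : lhs r k represents + pochℕ R k ℤ.* (Γℕ (1 + k) ℤ.* (Γℕ R ℤ.* + pochℕ 1 b))
    lhs-rep = ≋-trans
      (⊗-rep {poch r k} {Γp (ι (1 + k)) ⊗ (Γp r ⊗ poch (ι 1) b)} (poch-rep {r} r-rep k)
        (⊗-rep {Γp (ι (1 + k))} {Γp r ⊗ poch (ι 1) b} (Γp-rep {ι (1 + k)} (ι-rep (1 + k)))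
          (⊗-rep {Γp r} {poch (ι 1) b} (Γp-rep {r} r-rep) (poch-rep {ι 1} (ι-rep 1) b))))
      (≋-reflexive (cong₂ (λ u v → u ℤ.* (Γℕ (1 + k) ℤ.* (Γℕ R ℤ.* v))) (pochℤ-pos R k) (pochℤ-pos 1 b)))

    W-seq : Seq
    W-seq = pow ((dash r ⊕ ι b) ⊗ ι p) (ν a (digit0 (⊖ r)))

    W-rep : W-seq represents + W
    W-rep = ≋-trans
      (pow-rep {(dash r ⊕ ι b) ⊗ ι p}
        (⊗-rep {dash r ⊕ ι b} {ι p} (⊕-rep {dash r} {ι b} dash-rep (ι-rep b)) (ι-rep p)) (ν a (digit0 (⊖ r))))
      (≋-reflexive (trans (cong₂ powℤ base≡ (cong (ν a) (digit-neg ℓ))) (powℤ-pos ((t + b) * p) (ν a d))))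
      where
        base≡ : (+ t ℤ.+ + b) ℤ.* + p ≡ + ((t + b) * p)
        base≡ = trans (cong (ℤ._* + p) (sym (ℤP.pos-+ t b))) (sym (ℤP.pos-* (t + b) p))

    rhs-rep : rhs r k represents ℤ.- (Γℕ (R + k) ℤ.* (+ pochℕ 1 k ℤ.* (+ pochℕ t b ℤ.* + W)))
    rhs-rep = ⊖-rep {Γp (r ⊕ ι k) ⊗ (poch (ι 1) k ⊗ (poch (dash r) b ⊗ W-seq))}
      (⊗-rep {Γp (r ⊕ ι k)} {poch (ι 1) k ⊗ (poch (dash r) b ⊗ W-seq)}
        (Γp-rep {r ⊕ ι k} (≋-trans (⊕-rep {r} {ι k} r-rep (ι-rep k)) (≋-reflexive (sym (ℤP.pos-+ R k)))))
        (⊗-rep {poch (ι 1) k} {poch (dash r) b ⊗ W-seq} (≋-trans (poch-rep {ι 1} (ι-rep 1) k) (≋-reflexive (pochℤ-pos 1 k)))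
          (⊗-rep {poch (dash r) b} {W-seq} (≋-trans (poch-rep {dash r} dash-rep b) (≋-reflexive (pochℤ-pos t b))) W-rep)))

    -- the exact identity with the signs of Γ: Γ(1+k) = -(-1)^k U(1+k) and
    -- Γ(R+k) = (-1)^R (-1)^k U(R+k)
    signed-identity : + pochℕ R k ℤ.* (Γℕ (1 + k) ℤ.* (Γℕ R ℤ.* + pochℕ 1 b)) ≡
                      ℤ.- (Γℕ (R + k) ℤ.* (+ pochℕ 1 k ℤ.* (+ pochℕ t b ℤ.* + W)))
    signed-identity = begin
      + A ℤ.* (Γℕ (1 + k) ℤ.* (Γℕ R ℤ.* + B))
        ≡⟨ cong (λ s → + A ℤ.* ((s ℤ.* + U (1 + k)) ℤ.* (Γℕ R ℤ.* + B))) (sign-suc k) ⟩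
      + A ℤ.* ((ℤ.- sign k ℤ.* + U (1 + k)) ℤ.* ((sign R ℤ.* + U R) ℤ.* + B))
        ≡⟨ collect-signs (+ A) (+ U R) (+ U (1 + k)) (+ B) (sign k) (sign R) ⟩
      (ℤ.- sign k ℤ.* sign R) ℤ.* (+ A ℤ.* + U R ℤ.* + U (1 + k) ℤ.* + B)
        ≡⟨ cong ((ℤ.- sign k ℤ.* sign R) ℤ.*_) (trans (sym (pos-*⁴ A (U R) (U (1 + k)) B))
                                                 (trans (cong +_ exact-identity) (pos-*⁴ (U (R + k)) X T W))) ⟩
      (ℤ.- sign k ℤ.* sign R) ℤ.* (+ U (R + k) ℤ.* + X ℤ.* + T ℤ.* + W)
        ≡⟨ distribute-signs (+ U (R + k)) (+ X) (+ T) (+ W) (sign k) (sign R) ⟩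
      ℤ.- ((sign R ℤ.* sign k ℤ.* + U (R + k)) ℤ.* (+ X ℤ.* (+ T ℤ.* + W)))
        ≡⟨ cong (λ s → ℤ.- ((s ℤ.* + U (R + k)) ℤ.* (+ X ℤ.* (+ T ℤ.* + W)))) (sign-+ R k) ⟨
      ℤ.- (Γℕ (R + k) ℤ.* (+ X ℤ.* (+ T ℤ.* + W)))    ∎
      where
        open ≡-Reasoning
        A = pochℕ R k
        B = pochℕ 1 b
        X = pochℕ 1 k
        T = pochℕ t b
        pos-*⁴ : ∀ a b c d → + (a * b * c * d) ≡ + a ℤ.* + b ℤ.* + c ℤ.* + d
        pos-*⁴ a b c d = trans (ℤP.pos-* (a * b * c) d) (cong (ℤ._* + d)
                           (trans (ℤP.pos-* (a * b) c) (cong (ℤ._* + c) (ℤP.pos-* a b))))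
        collect-signs : ∀ A UR U1k B sk sR →
          A ℤ.* ((ℤ.- sk ℤ.* U1k) ℤ.* ((sR ℤ.* UR) ℤ.* B)) ≡ (ℤ.- sk ℤ.* sR) ℤ.* (A ℤ.* UR ℤ.* U1k ℤ.* B)
        collect-signs = ℤ-solve-∀
        distribute-signs : ∀ URk X T W sk sR →
          (ℤ.- sk ℤ.* sR) ℤ.* (URk ℤ.* X ℤ.* T ℤ.* W) ≡ ℤ.- ((sR ℤ.* sk ℤ.* URk) ℤ.* (X ℤ.* (T ℤ.* W)))
        distribute-signs = ℤ-solve-∀

    level-identity : md ℓ (lhs r k ℓ) ≡ md ℓ (rhs r k ℓ)
    level-identity = ≋⇒% (≋-trans lhs-rep (≋-trans (≋-reflexive signed-identity) (≋-sym rhs-rep)))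

  at-every-level : ∀ r → IsZp r → digit0 r ≢ 0 → ∀ k → lhs r k ≈ rhs r k
  at-every-level r _ _ k zero = trans (n%1≡0 (lhs r k 0)) (sym (n%1≡0 (rhs r k 0)))
  at-every-level r r∈ℤp digit≢0 k (suc n) = LevelIdentity.level-identity n r r∈ℤp digit≢0 k

lemma3p4 : (p : ℕ) .{{_ : NonZero p}} → Prime p → 5 < p → (k : ℕ) →
    let open Padic p in
    (r : Seq) → IsZp r → ¬ (digit0 r ≡ 0) →
    let a = k % p
        b = k / p
    in (poch r k ⊗ (Γp (ι (1 + k)) ⊗ (Γp r ⊗ poch (ι 1) b)))
       ≈ (⊖ (Γp (r ⊕ ι k) ⊗ (poch (ι 1) k ⊗ (poch (dash r) b
            ⊗ pow ((dash r ⊕ ι b) ⊗ ι p) (ν a (digit0 (⊖ r)))))))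
lemma3p4 p p-prime 5<p k r r∈ℤp digit≢0 =
  OddPrime.at-every-level p p-prime (≤-trans (s≤s (s≤s (s≤s z≤n))) 5<p) r r∈ℤp digit≢0 k
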